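{- Let $k \geq 2$ and let $A = \{a_0,a_1,\ldots,a_k\}$ be a finite set of integers with $0 = a_0 < a_1 < \cdots < a_k$ and $\gcd(A) = 1$. For every positive integer $t$, let \[ c'_t = (t a_k - 1)\sum_{j=1}^{k-1} a_j \quad\text{and}\quad d'_t = (k-1)(t a_k - 1)a_k. \] Then for all positive integers $t$ and $h$, \[ [c'_t, h a_k - d'_t] \subseteq (hA)^{(t)}. \]
   Context: For integers $u,v$, $[u,v] = \{n \in \mathbf{Z} : u \leq n \leq v\}$ (empty if $u > v$). For a set $A$ of integers and a positive integer $h$, the representation function $r_{A,h}(n)$ is the number of families $(u_a)_{a \in A}$ of nonnegative integers with $\sum_{a\in A} u_a a = n$ and $\sum_{a \in A} u_a = h$, i.e., the number of ways to write $n$ as an unordered sum of $h$ not necessarily distinct elements of $A$. For a positive integer $t$, $(hA)^{(t)} = \{n \in \mathbf{Z} : r_{A,h}(n) \geq t\}$. -}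

module Defs where

open import Data.Nat using (ℕ; zero; suc; _+_; _*_; _∸_; _≤_)
import Data.Nat
open import Data.Nat.GCD using (gcd)
open import Data.Integer as ℤ using (ℤ; +_)
import Data.Fin
open import Data.Fin using (Fin)
import Data.Vec
open import Data.Vec using (Vec; []; _∷_; toList)
open import Data.List using (allFin)
open import Data.List as List using (List; []; _∷_; length; filter; concatMap; map; upTo; foldr)
open import Relation.Nullary.Decidable using (Dec)
open import Relation.Binary.PropositionalEquality using (_≡_)

compositions : (m h : ℕ) → List (Vec ℕ m)
compositions zero    zero    = [] ∷ []
compositions zero    (suc h) = []
compositions (suc m) h =
  concatMap (λ u → map (u ∷_) (compositions m (h ∸ u))) (filterLe h)
  where
    filterLe : ℕ → List ℕ
    filterLe h = upTo (suc h)

dot : {m : ℕ} → Vec ℕ m → Vec ℕ m → ℕ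
dot []       []       = 0
dot (u ∷ us) (a ∷ as) = u * a + dot us as

-- r_{A,h}(n) for A = {a_0,…,a_k} given by the vector of its (distinct) elements:
-- number of families (u_a)_{a∈A} of nonnegative integers with Σ u_a = h and Σ u_a a = n
r : {m : ℕ} → Vec ℕ m → ℕ → ℤ → ℕ
r {m} a h n = length (filter (λ u → + (dot u a) ℤ.≟ n) (compositions m h))

InHAt : {m : ℕ} → Vec ℕ m → ℕ → ℕ → ℤ → Set
InHAt a h t n = t ≤ r a h n

gcdList : List ℕ → ℕ
gcdList = foldr gcd 0

sumList : List ℕ → ℕ
sumList = foldr _+_ 0

-- Σ_{j=1}^{k-1} a_j for a = (a_0,…,a_k)
midSum : {k : ℕ} → Vec ℕ (suc k) → ℕ
midSum {k} a = sumList (List.map (Data.Vec.lookup a) (List.filter (λ j → 1 Data.Nat.≤? Data.Fin.toℕ j) (List.filter (λ j → suc (Data.Fin.toℕ j) Data.Nat.≤? k) (allFin (suc k)))))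

module Submission where

-- Write the set as (0, m₁, …, m_{k-1}, M) with M = a_k, and put B = t·M - 1.
-- Fix N in the window [B·(m₁ + … + m_{k-1}), h·M - (k-1)·B·M].
--  (1) Since gcd(m₁, …, m_{k-1}, M) = 1, an integer Bézout combination scaled by N and
--      reduced modulo M gives residues 0 ≤ y_j < M with N ≡ Σ y_j m_j (mod M).  The lower
--      end of the window makes the quotient e = (N - Σ y_j m_j)/M a natural number.
--  (2) For s < t shift the first coordinate: x⁽ˢ⁾ = (y₁ + s·M, y₂, …, y_{k-1}) and
--      X_s = e - s·m₁.  All entries of x⁽ˢ⁾ are ≤ B, so Σ x⁽ˢ⁾_j m_j ≤ B·Σ m_j ≤ N, which
--      forces s·m₁ ≤ e; the upper end of the window forces Σ x⁽ˢ⁾ + X_s ≤ h.  Giving the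
--      element a₀ = 0 the remaining multiplicity turns (x⁽ˢ⁾, X_s) into a representation
--      of N as a sum of exactly h elements.
--  (3) These t representations are pairwise distinct, hence r_{A,h}(N) ≥ t.

open import Defs
open import Data.Fin as Fin using (Fin; zero; suc; toℕ; fromℕ)
open import Data.Fin.Properties using (injective⇒≤; toℕ-injective; toℕ<n)
open import Data.Vec as Vec using (Vec; []; _∷_; _∷ʳ_; lookup; toList; sum; initLast)
open import Data.Vec.Relation.Unary.All as All using (All; []; _∷_)
open import Data.List as List using (List; []; _∷_; length; filter; foldr; allFin)
open import Data.List.Membership.Propositional using (_∈_; lose)
open import Data.List.Membership.Propositional.Properties using (∈-filter⁺; ∈-concatMap⁺; ∈-upTo⁺; ∈-map⁺)
open import Data.List.Relation.Unary.Any using (here; index)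
open import Data.List.Relation.Unary.Any.Properties using (lookup-index)
open import Data.Nat.GCD using (gcd; gcd-GCD; gcd-identityˡ; gcd-identityʳ; module Bézout)
open import Data.Product using (∃₂; _×_; _,_)
open import Data.Bool using (if_then_else_)
open import Function using (case_of_)
open import Relation.Nullary using (Dec; does; yes; no)
open import Relation.Binary.PropositionalEquality

-- Step (1): integer combinations and reduction modulo M.
module IntegerArithmetic where

  open import Data.Nat as ℕ using (ℕ; NonZero)
  open import Data.Nat.Properties using (m+[n∸m]≡n)
  open import Data.Integer using (ℤ; +_; -_; _+_; _-_; _*_; _≤_; ∣_∣; _⊖_)
  open import Data.Integer.Properties using (pos-+; pos-*; abs-*; ⊖-≥; m-n≡m⊖n; *-zeroʳ; drop‿+≤+; +-monoˡ-≤)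
  open import Data.Integer.DivMod using (_%ℕ_; _/ℕ_; a≡a%ℕn+[a/ℕn]*n; n%ℕd<d)
  open import Data.Integer.Solver using (module +-*-Solver)
  open +-*-Solver
  open ≡-Reasoning

  dotℤ : ∀ {n} → Vec ℤ n → Vec ℕ n → ℤ
  dotℤ []       []       = + 0
  dotℤ (w ∷ ws) (x ∷ xs) = w * + x + dotℤ ws xs

  dotℤ-scale : ∀ {n} (c : ℤ) (w : Vec ℤ n) (xs : Vec ℕ n) →
               dotℤ (Vec.map (c *_) w) xs ≡ c * dotℤ w xs
  dotℤ-scale c []       []       = sym (*-zeroʳ c)
  dotℤ-scale c (w ∷ ws) (x ∷ xs) = begin
    c * w * + x + dotℤ (Vec.map (c *_) ws) xs ≡⟨ cong (λ d → c * w * + x + d) (dotℤ-scale c ws xs) ⟩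
    c * w * + x + c * dotℤ ws xs              ≡⟨ distribute c w (+ x) (dotℤ ws xs) ⟩
    c * (w * + x + dotℤ ws xs)                ∎
    where
    distribute = solve 4 (λ c w x d → c :* w :* x :+ c :* d := c :* (w :* x :+ d)) refl

  sum-identity-in-ℤ : ∀ {g b c : ℕ} → g ℕ.+ b ≡ c → + g ≡ + c - + b
  sum-identity-in-ℤ {g} {b} refl = begin
    + g               ≡⟨ solve 2 (λ g b → g := g :+ b :- b) refl (+ g) (+ b) ⟩
    + g + + b - + b   ≡⟨ cong (λ z → z - + b) (sym (pos-+ g b)) ⟩
    + (g ℕ.+ b) - + b ∎

  bezout : (x y : ℕ) → ∃₂ λ α β → α * + x + β * + y ≡ + gcd x y
  bezout x y with Bézout.identity (gcd-GCD x y)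
  ... | Bézout.+- α β eq = + α , - + β , (begin
    + α * + x + - + β * + y   ≡⟨ solve 4 (λ a x b y → a :* x :+ (:- b) :* y := a :* x :- b :* y)
                                        refl (+ α) (+ x) (+ β) (+ y) ⟩
    + α * + x - + β * + y     ≡⟨ cong₂ _-_ (sym (pos-* α x)) (sym (pos-* β y)) ⟩
    + (α ℕ.* x) - + (β ℕ.* y) ≡⟨ sym (sum-identity-in-ℤ eq) ⟩
    + gcd x y                 ∎)
  ... | Bézout.-+ α β eq = - + α , + β , (begin
    - + α * + x + + β * + y   ≡⟨ solve 4 (λ a x b y → (:- a) :* x :+ b :* y := b :* y :- a :* x)
                                        refl (+ α) (+ x) (+ β) (+ y) ⟩
    + β * + y - + α * + x     ≡⟨ cong₂ _-_ (sym (pos-* β y)) (sym (pos-* α x)) ⟩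
    + (β ℕ.* y) - + (α ℕ.* x) ≡⟨ sym (sum-identity-in-ℤ eq) ⟩
    + gcd x y                 ∎)

  bezout-vec : ∀ {n} (xs : Vec ℕ n) (M : ℕ) →
               ∃₂ λ w q → dotℤ w xs + q * + M ≡ + foldr gcd M (toList xs)
  bezout-vec []       M = [] , + 1 , solve 1 (λ M → con (+ 0) :+ con (+ 1) :* M := M) refl (+ M)
  bezout-vec (x ∷ xs) M with bezout-vec xs M | bezout x (foldr gcd M (toList xs))
  ... | w , q , eq | α , β , eq′ = α ∷ Vec.map (β *_) w , β * q , (begin
    α * + x + dotℤ (Vec.map (β *_) w) xs + β * q * + M
      ≡⟨ cong (λ d → α * + x + d + β * q * + M) (dotℤ-scale β w xs) ⟩
    α * + x + β * dotℤ w xs + β * q * + M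
      ≡⟨ solve 6 (λ a x b d q M → a :* x :+ b :* d :+ b :* q :* M := a :* x :+ b :* (d :+ q :* M))
               refl α (+ x) β (dotℤ w xs) q (+ M) ⟩
    α * + x + β * (dotℤ w xs + q * + M)
      ≡⟨ cong (λ g → α * + x + β * g) eq ⟩
    α * + x + β * + foldr gcd M (toList xs)
      ≡⟨ eq′ ⟩
    + gcd x (foldr gcd M (toList xs)) ∎)

  dotℤ-mod : ∀ {n} (A : ℕ) .{{_ : NonZero A}} (w : Vec ℤ n) (xs : Vec ℕ n) →
             dotℤ w xs ≡ + dot (Vec.map (_%ℕ A) w) xs + dotℤ (Vec.map (_/ℕ A) w) xs * + A
  dotℤ-mod A []       []       = refl
  dotℤ-mod A (w ∷ ws) (x ∷ xs) = begin
    w * + x + dotℤ ws xs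
      ≡⟨ cong₂ (λ v d → v * + x + d) (a≡a%ℕn+[a/ℕn]*n w A) (dotℤ-mod A ws xs) ⟩
    (+ ρ + κ * + A) * + x + (+ D + Q * + A)
      ≡⟨ solve 6 (λ r q A x D Q → (r :+ q :* A) :* x :+ (D :+ Q :* A) := (r :* x :+ D) :+ (q :* x :+ Q) :* A)
               refl (+ ρ) κ (+ A) (+ x) (+ D) Q ⟩
    (+ ρ * + x + + D) + (κ * + x + Q) * + A
      ≡⟨ cong (λ z → z + (κ * + x + Q) * + A) remainder-part ⟩
    + (ρ ℕ.* x ℕ.+ D) + (κ * + x + Q) * + A ∎
    where
    ρ = w %ℕ A
    κ = w /ℕ A
    D = dot (Vec.map (_%ℕ A) ws) xs
    Q = dotℤ (Vec.map (_/ℕ A) ws) xs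
    remainder-part : + ρ * + x + + D ≡ + (ρ ℕ.* x ℕ.+ D)
    remainder-part = trans (cong (λ z → z + + D) (sym (pos-* ρ x))) (sym (pos-+ (ρ ℕ.* x) D))

  residues-bounded : ∀ {n} (A : ℕ) .{{_ : NonZero A}} (w : Vec ℤ n) →
                     All (ℕ._< A) (Vec.map (_%ℕ A) w)
  residues-bounded A []       = []
  residues-bounded A (w ∷ ws) = n%ℕd<d w A ∷ residues-bounded A ws

  residue-representation : ∀ {n} (A : ℕ) .{{_ : NonZero A}} (ms : Vec ℕ n) →
    foldr gcd A (toList ms) ≡ 1 → (N : ℕ) →
    ∃₂ λ y E → All (ℕ._< A) y × + N ≡ + dot y ms + E * + A
  residue-representation A ms coprime N with bezout-vec ms A
  ... | w , q , eq = Vec.map (_%ℕ A) v , Q + + N * q , residues-bounded A v , (begin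
    + N                                 ≡⟨ solve 1 (λ N → N := N :* con (+ 1)) refl (+ N) ⟩
    + N * + 1                           ≡⟨ cong (+ N *_) (sym (trans eq (cong +_ coprime))) ⟩
    + N * (dotℤ w ms + q * + A)         ≡⟨ solve 4 (λ N d q A → N :* (d :+ q :* A) := N :* d :+ N :* q :* A)
                                                 refl (+ N) (dotℤ w ms) q (+ A) ⟩
    + N * dotℤ w ms + + N * q * + A     ≡⟨ cong (λ z → z + + N * q * + A) (sym (dotℤ-scale (+ N) w ms)) ⟩
    dotℤ v ms + + N * q * + A           ≡⟨ cong (λ z → z + + N * q * + A) (dotℤ-mod A v ms) ⟩
    + D + Q * + A + + N * q * + A       ≡⟨ solve 5 (λ D Q N q A → D :+ Q :* A :+ N :* q :* A := D :+ (Q :+ N :* q) :* A)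
                                                 refl (+ D) Q (+ N) q (+ A) ⟩
    + D + (Q + + N * q) * + A           ∎)
    where
    v = Vec.map (+ N *_) w
    D = dot (Vec.map (_%ℕ A) v) ms
    Q = dotℤ (Vec.map (_/ℕ A) v) ms

  natural-quotient : ∀ {N D A : ℕ} (E : ℤ) → D ℕ.≤ N → + N ≡ + D + E * + A → N ≡ D ℕ.+ ∣ E ∣ ℕ.* A
  natural-quotient {N} {D} {A} E D≤N eq = begin
    N                   ≡⟨ sym (m+[n∸m]≡n D≤N) ⟩
    D ℕ.+ (N ℕ.∸ D)     ≡⟨ cong (λ z → D ℕ.+ ∣ z ∣) difference ⟩
    D ℕ.+ ∣ E * + A ∣   ≡⟨ cong (D ℕ.+_) (abs-* E (+ A)) ⟩
    D ℕ.+ ∣ E ∣ ℕ.* A   ∎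
    where
    difference : + (N ℕ.∸ D) ≡ E * + A
    difference = begin
      + (N ℕ.∸ D)         ≡⟨ sym (⊖-≥ D≤N) ⟩
      N ⊖ D               ≡⟨ sym (m-n≡m⊖n N D) ⟩
      + N - + D           ≡⟨ cong (λ z → z - + D) eq ⟩
      + D + E * + A - + D ≡⟨ solve 3 (λ D E A → D :+ E :* A :- D := E :* A) refl (+ D) E (+ A) ⟩
      E * + A             ∎

  window-top : ∀ {N D X : ℕ} → + N ≤ + X - + D → N ℕ.+ D ℕ.≤ X
  window-top {N} {D} {X} N≤X-D = drop‿+≤+ (subst₂ _≤_ (sym (pos-+ N D)) X-D+D≡X (+-monoˡ-≤ (+ D) N≤X-D))
    where
    X-D+D≡X : + X - + D + + D ≡ + X
    X-D+D≡X = solve 2 (λ X D → X :- D :+ D := X) refl (+ X) (+ D)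

open IntegerArithmetic using (residue-representation; natural-quotient; window-top)

open import Data.Nat
open import Data.Nat.Properties
open import Data.Nat.Solver using (module +-*-Solver)
open import Data.Integer as ℤ using (ℤ; +_; ∣_∣)

sum-∷ʳ : ∀ {n} (xs : Vec ℕ n) (x : ℕ) → sum (xs ∷ʳ x) ≡ sum xs + x
sum-∷ʳ []       x = +-identityʳ x
sum-∷ʳ (y ∷ xs) x = trans (cong (_+_ y) (sum-∷ʳ xs x)) (sym (+-assoc y (sum xs) x))

dot-∷ʳ : ∀ {n} (xs ms : Vec ℕ n) (x m : ℕ) → dot (xs ∷ʳ x) (ms ∷ʳ m) ≡ dot xs ms + x * m
dot-∷ʳ []       []       x m = +-identityʳ (x * m)
dot-∷ʳ (y ∷ xs) (n ∷ ms) x m =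
  trans (cong (_+_ (y * n)) (dot-∷ʳ xs ms x m)) (sym (+-assoc (y * n) (dot xs ms) (x * m)))

lookup-last : ∀ {n} (xs : Vec ℕ n) (x : ℕ) → lookup (xs ∷ʳ x) (fromℕ n) ≡ x
lookup-last []       x = refl
lookup-last (y ∷ xs) x = lookup-last xs x

gcdList-∷ʳ : ∀ {n} (xs : Vec ℕ n) (x : ℕ) → gcdList (toList (xs ∷ʳ x)) ≡ foldr gcd x (toList xs)
gcdList-∷ʳ []       x = gcd-identityʳ x
gcdList-∷ʳ (y ∷ xs) x = cong (gcd y) (gcdList-∷ʳ xs x)

-- Turning
-- the filters into 0/1 gates and the list over allFin into an iterated sum over Fin makes
-- it computable by induction on the vector.

gate : ∀ {P : Set} → Dec P → ℕ → ℕ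
gate d n = if does d then n else 0

sum-filter : ∀ {X : Set} {P : X → Set} (P? : ∀ x → Dec (P x)) (g : X → ℕ) (xs : List X) →
  sumList (List.map g (filter P? xs)) ≡ sumList (List.map (λ x → gate (P? x) (g x)) xs)
sum-filter P? g []       = refl
sum-filter P? g (x ∷ xs) with P? x
... | yes _ = cong (_+_ (g x)) (sum-filter P? g xs)
... | no  _ = sum-filter P? g xs

sumFin : (n : ℕ) → (Fin n → ℕ) → ℕ
sumFin zero    f = 0
sumFin (suc n) f = f zero + sumFin n (λ i → f (suc i))

sum-tabulate : ∀ {X : Set} n (f : Fin n → X) (g : X → ℕ) →
  sumList (List.map g (List.tabulate f)) ≡ sumFin n (λ i → g (f i))
sum-tabulate zero    f g = refl
sum-tabulate (suc n) f g = cong (_+_ (g (f zero))) (sum-tabulate n (λ i → f (suc i)) g)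

-- After removing the (always excluded) index 0, the gate on j + 1 ≤ k keeps exactly the
-- entries before the last one.
gated-init-sum : ∀ n (ms : Vec ℕ n) (x : ℕ) →
  sumFin (suc n) (λ i → if (suc (suc (toℕ i)) ≤ᵇ suc n) then lookup (ms ∷ʳ x) i else 0) ≡ sum ms
gated-init-sum .0       []       x = refl
gated-init-sum (suc n) (m ∷ ms) x = cong (_+_ m) (gated-init-sum n ms x)

midSum-∷ʳ : ∀ n (a₀ x : ℕ) (ms : Vec ℕ n) → midSum {suc n} (a₀ ∷ (ms ∷ʳ x)) ≡ sum ms
midSum-∷ʳ n a₀ x ms = begin
  midSum a
    ≡⟨ sum-filter positive (lookup a) (filter notLast (allFin (suc (suc n)))) ⟩
  sumList (List.map (λ j → gate (positive j) (lookup a j)) (filter notLast (allFin (suc (suc n)))))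
    ≡⟨ sum-filter notLast (λ j → gate (positive j) (lookup a j)) (allFin (suc (suc n))) ⟩
  sumList (List.map (λ j → gate (notLast j) (gate (positive j) (lookup a j))) (allFin (suc (suc n))))
    ≡⟨ sum-tabulate (suc (suc n)) (λ j → j) (λ j → gate (notLast j) (gate (positive j) (lookup a j))) ⟩
  sumFin (suc (suc n)) (λ j → gate (notLast j) (gate (positive j) (lookup a j)))
    ≡⟨ gated-init-sum n ms x ⟩
  sum ms ∎
  where
  open ≡-Reasoning
  a = a₀ ∷ (ms ∷ʳ x)
  positive : (j : Fin (suc (suc n))) → Dec (1 ≤ toℕ j)
  positive j = 1 ≤? toℕ j
  notLast : (j : Fin (suc (suc n))) → Dec (suc (toℕ j) ≤ suc n)
  notLast j = suc (toℕ j) ≤? suc n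

-- Counting: t distinct representations bound r from below (step (3)).

compositions-complete : ∀ {m} (u : Vec ℕ m) → u ∈ compositions m (sum u)
compositions-complete []               = here refl
compositions-complete {suc m} (x ∷ us) =
  ∈-concatMap⁺ (λ v → List.map (v ∷_) (compositions m (x + sum us ∸ v)))
    (lose (∈-upTo⁺ (s≤s (m≤m+n x (sum us))))
    (∈-map⁺ (x ∷_) (subst (λ s → us ∈ compositions m s) (sym (m+n∸m≡n x (sum us)))
                           (compositions-complete us))))

distinct-members-≤-length : ∀ {t} {X : Set} (ys : List X) (f : Fin t → X) →
  (∀ {i j} → f i ≡ f j → i ≡ j) → (∀ i → f i ∈ ys) → t ≤ length ys
distinct-members-≤-length ys f f-injective member =
  injective⇒≤ {f = λ i → index (member i)} λ {i} {j} same-index → f-injective (begin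
    f i                              ≡⟨ lookup-index (member i) ⟩
    List.lookup ys (index (member i)) ≡⟨ cong (List.lookup ys) same-index ⟩
    List.lookup ys (index (member j)) ≡⟨ sym (lookup-index (member j)) ⟩
    f j                              ∎)
  where open ≡-Reasoning

distinct-representations-≤-r : ∀ {m t h N} (a : Vec ℕ m) (u : Fin t → Vec ℕ m) →
  (∀ {i j} → u i ≡ u j → i ≡ j) → (∀ i → sum (u i) ≡ h) → (∀ i → dot (u i) a ≡ N) →
  t ≤ r a h (+ N)
distinct-representations-≤-r {m} {h = h} {N} a u u-injective size value =
  distinct-members-≤-length (filter (λ w → + dot w a ℤ.≟ + N) (compositions m h)) u u-injective λ i →
    ∈-filter⁺ (λ w → + dot w a ℤ.≟ + N)
      (subst (λ s → u i ∈ compositions m s) (size i) (compositions-complete (u i)))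
      (cong +_ (value i))

dot-bound : ∀ {n} (B : ℕ) (xs ms : Vec ℕ n) → All (_≤ B) xs → dot xs ms ≤ B * sum ms
dot-bound B []       []       []       = z≤n
dot-bound B (x ∷ xs) (m ∷ ms) (x≤B ∷ xs≤B) =
  subst (x * m + dot xs ms ≤_) (sym (*-distribˡ-+ B m (sum ms)))
    (+-mono-≤ (*-monoˡ-≤ m x≤B) (dot-bound B xs ms xs≤B))

sum-bound : ∀ {n} (B : ℕ) (xs : Vec ℕ n) → All (_≤ B) xs → sum xs ≤ n * B
sum-bound B []       []          = z≤n
sum-bound B (x ∷ xs) (x≤B ∷ xs≤B) = +-mono-≤ x≤B (sum-bound B xs xs≤B)

digit-≤ : ∀ {A t} y s → y < A → s < t → y + s * A ≤ t * A ∸ 1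
digit-≤ {A} y s y<A s<t = below (≤-trans (+-monoˡ-≤ (s * A) y<A) (*-monoˡ-≤ A s<t))
  where
  below : ∀ {x n} → suc x ≤ n → x ≤ n ∸ 1
  below {n = suc n} (s≤s x≤n) = x≤n

residue-≤ : ∀ {A t} y → y < A → 1 ≤ t → y ≤ t * A ∸ 1
residue-≤ y y<A 1≤t = subst (_≤ _) (+-identityʳ y) (digit-≤ y 0 y<A 1≤t)

-- Step (2): the t shifted representations of a fixed N in the window.  The parameters are
-- the data produced by step (1): residues y₁ ∷ ys below M and the quotient e.
module ShiftedRepresentations
  {m : ℕ} (M : ℕ) .{{_ : NonZero M}} (m₁ : ℕ) (ms : Vec ℕ m) (t h N : ℕ)
  (lower : (t * M ∸ 1) * sum (m₁ ∷ ms) ≤ N)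
  (upper : N + suc m * (t * M ∸ 1) * M ≤ h * M)
  (y₁ : ℕ) (ys : Vec ℕ m) (y₁<M : y₁ < M) (ys<M : All (_< M) ys)
  (e : ℕ) (decomposition : N ≡ dot (y₁ ∷ ys) (m₁ ∷ ms) + e * M)
  where

  open +-*-Solver

  B : ℕ
  B = t * M ∸ 1

  shifted : ℕ → Vec ℕ (suc m)
  shifted s = (y₁ + s * M) ∷ ys

  topCount : ℕ → ℕ
  topCount s = e ∸ s * m₁

  -- The full coefficient vector for (0, m₁, …, m_{k-1}, M); a₀ = 0 absorbs the missing
  -- multiplicity.
  representation : ℕ → Vec ℕ (suc (suc (suc m)))
  representation s = (h ∸ (sum (shifted s) + topCount s)) ∷ (shifted s ∷ʳ topCount s)

  shifted-dot : ∀ s → dot (shifted s) (m₁ ∷ ms) ≡ dot (y₁ ∷ ys) (m₁ ∷ ms) + s * m₁ * M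
  shifted-dot s = solve 5 (λ y s M m R → (y :+ s :* M) :* m :+ R := (y :* m :+ R) :+ s :* m :* M)
                          refl y₁ s M m₁ (dot ys ms)

  module _ (s : ℕ) (s<t : s < t) where

    shifted-≤B : All (_≤ B) (shifted s)
    shifted-≤B = digit-≤ y₁ s y₁<M s<t ∷ All.map (λ {y} y<M → residue-≤ y y<M (≤-trans (s≤s z≤n) s<t)) ys<M

    -- Σ x⁽ˢ⁾_j m_j ≤ B·Σ m_j ≤ N = Σ y_j m_j + e·M, hence s·m₁ ≤ e, so that
    -- X_s = e - s·m₁ involves no truncated subtraction.
    shift-affordable : s * m₁ ≤ e
    shift-affordable = *-cancelʳ-≤ (s * m₁) e M
      (+-cancelˡ-≤ (dot (y₁ ∷ ys) (m₁ ∷ ms)) _ _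
        (subst₂ _≤_ (shifted-dot s) decomposition
          (≤-trans (dot-bound B (shifted s) (m₁ ∷ ms) shifted-≤B) lower)))

    shifted-decomposition : N ≡ dot (shifted s) (m₁ ∷ ms) + topCount s * M
    shifted-decomposition = begin
      N                                           ≡⟨ decomposition ⟩
      D + e * M                                   ≡⟨ cong (λ z → D + z * M) (sym (m+[n∸m]≡n shift-affordable)) ⟩
      D + (s * m₁ + topCount s) * M               ≡⟨ solve 4 (λ D p x M → D :+ (p :+ x) :* M := (D :+ p :* M) :+ x :* M)
                                                           refl D (s * m₁) (topCount s) M ⟩
      D + s * m₁ * M + topCount s * M             ≡⟨ cong (_+ topCount s * M) (sym (shifted-dot s)) ⟩
      dot (shifted s) (m₁ ∷ ms) + topCount s * M  ∎
      where
      open ≡-Reasoning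
      D = dot (y₁ ∷ ys) (m₁ ∷ ms)

    -- (Σ x⁽ˢ⁾ + X_s)·M ≤ (k-1)·B·M + N ≤ h·M.
    shifted-size : sum (shifted s) + topCount s ≤ h
    shifted-size = *-cancelʳ-≤ _ h M (begin
      (sum (shifted s) + topCount s) * M     ≡⟨ *-distribʳ-+ M (sum (shifted s)) (topCount s) ⟩
      sum (shifted s) * M + topCount s * M   ≤⟨ +-mono-≤ (*-monoˡ-≤ M (sum-bound B (shifted s) shifted-≤B))
                                                          (subst (topCount s * M ≤_) (sym shifted-decomposition) (m≤n+m _ _)) ⟩
      suc m * B * M + N                      ≡⟨ +-comm _ N ⟩
      N + suc m * B * M                      ≤⟨ upper ⟩
      h * M                                  ∎)
      where open ≤-Reasoning

    representation-size : sum (representation s) ≡ h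
    representation-size =
      trans (cong (_+_ (h ∸ (sum (shifted s) + topCount s))) (sum-∷ʳ (shifted s) (topCount s)))
            (m∸n+n≡m shifted-size)

    representation-value : dot (representation s) (0 ∷ ((m₁ ∷ ms) ∷ʳ M)) ≡ N
    representation-value =
      trans (cong₂ _+_ (*-zeroʳ (h ∸ (sum (shifted s) + topCount s)))
                       (dot-∷ʳ (shifted s) (m₁ ∷ ms) (topCount s) M))
            (sym shifted-decomposition)

  -- Distinct shifts give distinct representations, as the coefficients of m₁ differ.
  representation-injective : ∀ {i j} → representation i ≡ representation j → i ≡ j
  representation-injective {i} {j} eq =
    *-cancelʳ-≡ i j M (+-cancelˡ-≡ y₁ _ _ (cong (λ w → Vec.head (Vec.tail w)) eq))

  at-least-t : t ≤ r (0 ∷ ((m₁ ∷ ms) ∷ʳ M)) h (+ N)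
  at-least-t = distinct-representations-≤-r (0 ∷ ((m₁ ∷ ms) ∷ʳ M)) (λ i → representation (toℕ i))
    (λ eq → toℕ-injective (representation-injective eq))
    (λ i → representation-size (toℕ i) (toℕ<n i))
    (λ i → representation-value (toℕ i) (toℕ<n i))

-- The theorem in natural-number form, for A = (0, m₁, …, m_{k-1}, M) with k - 1 = suc m.
window-⊆-hA⁽ᵗ⁾ : ∀ {m} (M : ℕ) .{{_ : NonZero M}} (m₁ : ℕ) (ms : Vec ℕ m) →
  foldr gcd M (toList (m₁ ∷ ms)) ≡ 1 → (t h N : ℕ) → 1 ≤ t →
  (t * M ∸ 1) * sum (m₁ ∷ ms) ≤ N →
  N + suc m * (t * M ∸ 1) * M ≤ h * M →
  t ≤ r (0 ∷ ((m₁ ∷ ms) ∷ʳ M)) h (+ N)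
window-⊆-hA⁽ᵗ⁾ M m₁ ms coprime t h N 1≤t lower upper =
  case residue-representation M (m₁ ∷ ms) coprime N of λ where
    (y₁ ∷ ys , E , y₁<M ∷ ys<M , eq) →
      ShiftedRepresentations.at-least-t M m₁ ms t h N lower upper y₁ ys y₁<M ys<M ∣ E ∣
        (natural-quotient E (remainder≤N (y₁<M ∷ ys<M)) eq)
  where
  remainder≤N : ∀ {y} → All (_< M) y → dot y (m₁ ∷ ms) ≤ N
  remainder≤N {y} y<M = ≤-trans (dot-bound (t * M ∸ 1) y (m₁ ∷ ms) (All.map (λ {x} x<M → residue-≤ x x<M 1≤t) y<M)) lower

-- The same for an integer n, as (hA)^(t) is a set of integers; the window has no
-- negative elements.
window-⊆-hA⁽ᵗ⁾-ℤ : ∀ {m} (M : ℕ) .{{_ : NonZero M}} (m₁ : ℕ) (ms : Vec ℕ m) →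
  foldr gcd M (toList (m₁ ∷ ms)) ≡ 1 → (t h : ℕ) → 1 ≤ t → (n : ℤ) →
  + ((t * M ∸ 1) * sum (m₁ ∷ ms)) ℤ.≤ n →
  n ℤ.≤ + (h * M) ℤ.- + (suc m * (t * M ∸ 1) * M) →
  InHAt (0 ∷ ((m₁ ∷ ms) ∷ʳ M)) h t n
window-⊆-hA⁽ᵗ⁾-ℤ M m₁ ms coprime t h 1≤t (+ N) (ℤ.+≤+ lower) upper =
  window-⊆-hA⁽ᵗ⁾ M m₁ ms coprime t h N 1≤t lower (window-top upper)

lemma2 : (k : ℕ) → 2 ≤ k → (a : Vec ℕ (suc k)) →
         lookup a zero ≡ 0 →
         (∀ (i j : Fin (suc k)) → i Fin.< j → lookup a i < lookup a j) →
         gcdList (toList a) ≡ 1 →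
         (t h : ℕ) → 1 ≤ t → 1 ≤ h →
         (n : ℤ) →
         + ((t * lookup a (fromℕ k) ∸ 1) * midSum a) ℤ.≤ n →
         n ℤ.≤ + (h * lookup a (fromℕ k)) ℤ.- + ((k ∸ 1) * (t * lookup a (fromℕ k) ∸ 1) * lookup a (fromℕ k)) →
         InHAt a h t n
lemma2 (suc (suc m)) (s≤s (s≤s z≤n)) (a₀ ∷ as) refl increasing coprime t h 1≤t _ with initLast as
... | m₁ ∷ ms , M , refl
  rewrite midSum-∷ʳ (suc m) 0 M (m₁ ∷ ms) | lookup-last (m₁ ∷ ms) M =
  window-⊆-hA⁽ᵗ⁾-ℤ M {{>-nonZero M>0}} m₁ ms coprime′ t h 1≤t
  where
  M>0 : 0 < M
  M>0 = subst (0 <_) (lookup-last (m₁ ∷ ms) M) (increasing zero (fromℕ (suc (suc m))) (s≤s z≤n))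
  coprime′ : foldr gcd M (toList (m₁ ∷ ms)) ≡ 1
  coprime′ = trans (sym (gcdList-∷ʳ (m₁ ∷ ms) M)) (trans (sym (gcd-identityˡ _)) coprime)
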